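{- Let $\mathbf{SupOMLatLin}$ and $\mathbf{OMSupGal}$ be the dagger categories described in the context. Define $\Lambda\colon\mathbf{SupOMLatLin}\to\mathbf{OMSupGal}$ and $\Gamma\colon\mathbf{OMSupGal}\to\mathbf{SupOMLatLin}$ to be the identity on objects and, on morphisms, $\Lambda(f)=(f_{\bullet},f^{\bullet})=(\perp\circ f,\ \perp\circ f^{*})$ and $\Gamma(f_{\bullet},f^{\bullet})=\perp\circ f_{\bullet}$, where $\perp$ denotes the orthocomplement map. Then $\Lambda$ and $\Gamma$ are well defined, and they exhibit $\mathbf{SupOMLatLin}$ and $\mathbf{OMSupGal}$ as dagger isomorphic: $\Lambda$ is full, faithful and (being the identity on objects) essentially surjective, $\Lambda\circ\Gamma$ is the identity on morphisms, and $\Lambda(f^{*})=\Lambda(f)^{*}$ for every morphism $f$.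
   Context: An orthomodular lattice is a lattice $X$ with $0,1$ and an orthocomplement $x\mapsto x^{\perp}$ (involutive, order-reversing, $x\wedge x^{\perp}=0$) satisfying: $x\le y$ implies $y=x\vee(x^{\perp}\wedge y)$; complete means all joins exist. Write $x\perp y$ iff $x\le y^{\perp}$. $\mathbf{SupOMLatLin}$: objects are complete orthomodular lattices; morphisms $f\colon X\to Y$ are functions admitting a function $f^{*}\colon Y\to X$ (necessarily unique, the adjoint) with $f(x)\perp y$ iff $x\perp f^{*}(y)$ for all $x\in X,y\in Y$; composition is composition of functions; dagger is $f\mapsto f^{*}$. $\mathbf{OMSupGal}$: objects are complete orthomodular lattices; a morphism $X\to Y$ is a pair $(f_{\bullet},f^{\bullet})$ of functions $f_{\bullet}\colon X\to Y$, $f^{\bullet}\colon Y\to X$ with $x\le f^{\bullet}(y)$ iff $y\le f_{\bullet}(x)$ for all $x\in X$, $y\in Y$; the identity on $X$ is $(\perp,\perp)$; composition is $(g\circ f)_{\bullet}=g_{\bullet}\circ\perp\circ f_{\bullet}$, $(g\circ f)^{\bullet}=f^{\bullet}\circ\perp\circ g^{\bullet}$; the dagger is $(f_{\bullet},f^{\bullet})^{*}=(f^{\bullet},f_{\bullet})$. Two dagger categories are dagger isomorphic if there is a functor between them that is full, faithful, essentially surjective and preserves the dagger. -}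

module Defs where

open import Level using (Level; _⊔_; suc)
open import Function using (_∘_; id)
open import Data.Product using (Σ; _×_; _,_; proj₁; proj₂)
open import Relation.Binary.PropositionalEquality using (_≡_)
open import Relation.Binary.Structures using (IsPartialOrder)

record COML (c ℓ : Level) : Set (suc (c ⊔ ℓ)) where
  infix 4 _≤_
  infixr 6 _∧_
  infixr 5 _∨_
  infix 9 _ᶜ
  field
    Carrier   : Set c
    _≤_       : Carrier → Carrier → Set ℓ
    isPartialOrder : IsPartialOrder _≡_ _≤_
    𝟘 𝟙       : Carrier
    𝟘-min     : ∀ x → 𝟘 ≤ x
    𝟙-max     : ∀ x → x ≤ 𝟙
    _∧_ _∨_   : Carrier → Carrier → Carrier
    ∧-lb₁     : ∀ x y → x ∧ y ≤ x
    ∧-lb₂     : ∀ x y → x ∧ y ≤ y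
    ∧-glb     : ∀ x y z → z ≤ x → z ≤ y → z ≤ x ∧ y
    ∨-ub₁     : ∀ x y → x ≤ x ∨ y
    ∨-ub₂     : ∀ x y → y ≤ x ∨ y
    ∨-lub     : ∀ x y z → x ≤ z → y ≤ z → x ∨ y ≤ z
    ⋁         : (Carrier → Set c) → Carrier
    ⋁-ub      : ∀ (S : Carrier → Set c) x → S x → x ≤ ⋁ S
    ⋁-lub     : ∀ (S : Carrier → Set c) z → (∀ x → S x → x ≤ z) → ⋁ S ≤ z
    _ᶜ        : Carrier → Carrier
    ᶜ-invol   : ∀ x → (x ᶜ) ᶜ ≡ x
    ᶜ-antitone : ∀ x y → x ≤ y → y ᶜ ≤ x ᶜ
    ᶜ-meet    : ∀ x → x ∧ x ᶜ ≡ 𝟘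
    orthomodular : ∀ x y → x ≤ y → y ≡ x ∨ (x ᶜ ∧ y)

  infix 4 _⟂_
  _⟂_ : Carrier → Carrier → Set ℓ
  x ⟂ y = x ≤ y ᶜ

open COML public using (Carrier)

_⇔_ : ∀ {a b} → Set a → Set b → Set (a ⊔ b)
A ⇔ B = (A → B) × (B → A)

module _ {c ℓ : Level} (X Y : COML c ℓ) where
  private
    module X = COML X
    module Y = COML Y

  IsAdjoint : (Carrier X → Carrier Y) → (Carrier Y → Carrier X) → Set (c ⊔ ℓ)
  IsAdjoint f g = ∀ x y → (f x Y.⟂ y) ⇔ (x X.⟂ g y)

  HasAdjoint : (Carrier X → Carrier Y) → Set (c ⊔ ℓ)
  HasAdjoint f = Σ (Carrier Y → Carrier X) (IsAdjoint f)

  IsGalois : (Carrier X → Carrier Y) → (Carrier Y → Carrier X) → Set (c ⊔ ℓ)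
  IsGalois f• f•′ = ∀ x y → (x X.≤ f•′ y) ⇔ (y Y.≤ f• x)

-- Morphisms of SupOMLatLin: a function together with its (necessarily
-- unique) adjoint.  Equality of morphisms is equality of the underlying
-- functions (the adjoint is determined by it).
record LinMor {c ℓ : Level} (X Y : COML c ℓ) : Set (c ⊔ ℓ) where
  field
    fun   : Carrier X → Carrier Y
    adj   : Carrier Y → Carrier X
    isAdj : IsAdjoint X Y fun adj
open LinMor public

record GalMor {c ℓ : Level} (X Y : COML c ℓ) : Set (c ⊔ ℓ) where
  field
    low   : Carrier X → Carrier Y
    up    : Carrier Y → Carrier X
    isGal : IsGalois X Y low up
open GalMor public

infixr 4 _,,_
record GalPair {c ℓ} (X Y : COML c ℓ) : Set c where
  constructor _,,_
  field
    ₁ : Carrier X → Carrier Y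
    ₂ : Carrier Y → Carrier X

_≐_ : ∀ {a b} {A : Set a} {B : Set b} → (A → B) → (A → B) → Set (a ⊔ b)
f ≐ g = ∀ x → f x ≡ g x

_≐₂_ : ∀ {c ℓ} {X Y : COML c ℓ} → GalPair X Y → GalPair X Y → Set c
(f ,, f′) ≐₂ (g ,, g′) = (f ≐ g) × (f′ ≐ g′)

idGal : ∀ {c ℓ} (X : COML c ℓ) → GalPair X X
idGal X = COML._ᶜ X ,, COML._ᶜ X

compGal : ∀ {c ℓ} {X Y Z : COML c ℓ} → GalPair Y Z → GalPair X Y → GalPair X Z
compGal {Y = Y} (g ,, g′) (f ,, f′) = g ∘ COML._ᶜ Y ∘ f ,, f′ ∘ COML._ᶜ Y ∘ g′

daggerGal : ∀ {c ℓ} {X Y : COML c ℓ} → GalPair X Y → GalPair Y X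
daggerGal (f ,, f′) = f′ ,, f

Λ : ∀ {c ℓ} (X Y : COML c ℓ) → (Carrier X → Carrier Y) → (Carrier Y → Carrier X) → GalPair X Y
Λ X Y f f* = COML._ᶜ Y ∘ f ,, COML._ᶜ X ∘ f*

Λ-mor : ∀ {c ℓ} {X Y : COML c ℓ} → LinMor X Y → GalPair X Y
Λ-mor {X = X} {Y} f = Λ X Y (fun f) (adj f)

Γ : ∀ {c ℓ} {X Y : COML c ℓ} → GalPair X Y → (Carrier X → Carrier Y)
Γ {Y = Y} (f• ,, _) = COML._ᶜ Y ∘ f•

pair : ∀ {c ℓ} {X Y : COML c ℓ} → GalMor X Y → GalPair X Y
pair g = low g ,, up g

IsGaloisPair : ∀ {c ℓ} (X Y : COML c ℓ) → GalPair X Y → Set (c ⊔ ℓ)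
IsGaloisPair X Y (f• ,, f•′) = IsGalois X Y f• f•′

-- Since ⊥ is an involutive order anti-automorphism, f x ⟂ y reads ⊥ (f x) ≥ y
-- and x ⟂ g y reads x ≤ ⊥ (g y): so g is an adjoint of f exactly when
-- (⊥ ∘ f , ⊥ ∘ g) is a Galois pair. Λ and Γ merely insert or cancel one ⊥,
-- and every functoriality equation is an instance of ⊥ ∘ ⊥ = id.
module Submission where

open import Defs
open import Level using (Level)
open import Function using (_∘_; id)
open import Data.Product using (Σ; _×_; _,_; proj₁; proj₂)
open import Relation.Binary.PropositionalEquality using (_≡_; refl; sym; cong; subst)
open import Relation.Binary.Structures using (IsPartialOrder)

module Ortho {c ℓ} (X : COML c ℓ) where
  open COML X
  open IsPartialOrder isPartialOrder using (antisym; reflexive)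

  ᶜ-injective : ∀ {a b} → a ᶜ ≡ b ᶜ → a ≡ b
  ᶜ-injective {a} {b} e = subst (_≡ b) (ᶜ-invol a) (subst ((a ᶜ) ᶜ ≡_) (ᶜ-invol b) (cong _ᶜ e))

  ᶜ-reflects-≤ : ∀ {a b} → b ᶜ ≤ a ᶜ → a ≤ b
  ᶜ-reflects-≤ {a} {b} p =
    subst (_≤ b) (ᶜ-invol a) (subst ((a ᶜ) ᶜ ≤_) (ᶜ-invol b) (ᶜ-antitone _ _ p))

  ⟂-sym : ∀ {a b} → a ⟂ b → b ⟂ a
  ⟂-sym {a} {b} p = subst (_≤ a ᶜ) (ᶜ-invol b) (ᶜ-antitone a (b ᶜ) p)

  ≤ᶜᶜ⇔≤ : ∀ a b → (a ≤ (b ᶜ) ᶜ) ⇔ (a ≤ b)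
  ≤ᶜᶜ⇔≤ a b = subst (a ≤_) (ᶜ-invol b) , subst (a ≤_) (sym (ᶜ-invol b))

  ≤-ext : ∀ {a b} → (∀ x → x ≤ a → x ≤ b) → (∀ x → x ≤ b → x ≤ a) → a ≡ b
  ≤-ext f g = antisym (f _ (reflexive refl)) (g _ (reflexive refl))

module _ {c ℓ} {X Y : COML c ℓ} where
  private
    module X = COML X
    module Y = COML Y
    module OX = Ortho X
    module OY = Ortho Y

  IsAdjoint-sym : ∀ {f g} → IsAdjoint X Y f g → IsAdjoint Y X g f
  IsAdjoint-sym adj y x =
      (λ p → OY.⟂-sym (proj₂ (adj x y) (OX.⟂-sym p)))
    , (λ q → OX.⟂-sym (proj₁ (adj x y) (OY.⟂-sym q)))

  IsAdjoint⇒IsGalois : ∀ {f g} → IsAdjoint X Y f g → IsGalois X Y (Y._ᶜ ∘ f) (X._ᶜ ∘ g)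
  IsAdjoint⇒IsGalois adj x y =
      (λ p → OY.⟂-sym (proj₂ (adj x y) p))
    , (λ q → proj₁ (adj x y) (OY.⟂-sym q))

  IsGalois⇒IsAdjoint : ∀ {f• f•′} → IsGalois X Y f• f•′ → IsAdjoint X Y (Y._ᶜ ∘ f•) (X._ᶜ ∘ f•′)
  IsGalois⇒IsAdjoint {f•} {f•′} gal x y =
      (λ p → proj₂ (OX.≤ᶜᶜ⇔≤ x (f•′ y)) (proj₂ (gal x y) (OY.ᶜ-reflects-≤ p)))
    , (λ q → Y.ᶜ-antitone y (f• x) (proj₁ (gal x y) (proj₁ (OX.≤ᶜᶜ⇔≤ x (f•′ y)) q)))

  IsGalois-unique : ∀ {f• g• f•′ g•′} → f• ≐ g• →
                    IsGalois X Y f• f•′ → IsGalois X Y g• g•′ → f•′ ≐ g•′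
  IsGalois-unique e f g y = OX.≤-ext
    (λ x p → proj₂ (g x y) (subst (y Y.≤_) (e x) (proj₁ (f x y) p)))
    (λ x p → proj₂ (f x y) (subst (y Y.≤_) (sym (e x)) (proj₁ (g x y) p)))

  Γ-adjoint : (g : GalMor X Y) → IsAdjoint X Y (Γ (pair g)) (X._ᶜ ∘ up g)
  Γ-adjoint g = IsGalois⇒IsAdjoint (isGal g)

  Γ-mor : GalMor X Y → LinMor X Y
  Γ-mor g = record { fun = Γ (pair g) ; adj = X._ᶜ ∘ up g ; isAdj = Γ-adjoint g }

  Λ∘Γ≐id : (g : GalMor X Y) (h : Carrier Y → Carrier X)
         → IsAdjoint X Y (Γ (pair g)) h → Λ X Y (Γ (pair g)) h ≐₂ pair g
  Λ∘Γ≐id g h adj = ᶜᶜ-low , IsGalois-unique ᶜᶜ-low (IsAdjoint⇒IsGalois adj) (isGal g)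
    where
    ᶜᶜ-low : (Y._ᶜ ∘ Γ (pair g)) ≐ low g
    ᶜᶜ-low = Y.ᶜ-invol ∘ low g

  Λ-faithful : (f g : LinMor X Y) → Λ-mor f ≐₂ Λ-mor g → fun f ≐ fun g
  Λ-faithful f g (e , _) x = OY.ᶜ-injective (e x)

Λ-comp : ∀ {c ℓ} {X Y Z : COML c ℓ} (f : LinMor X Y) (g : LinMor Y Z)
       → Λ X Z (fun g ∘ fun f) (adj f ∘ adj g) ≐₂ compGal (Λ-mor g) (Λ-mor f)
Λ-comp {X = X} {Y} {Z} f g =
    (λ x → cong (COML._ᶜ Z ∘ fun g) (sym (COML.ᶜ-invol Y (fun f x))))
  , (λ z → cong (COML._ᶜ X ∘ adj f) (sym (COML.ᶜ-invol Y (adj g z))))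

theorem3 : ∀ {c ℓ : Level}
    → (∀ {X Y : COML c ℓ} (f : LinMor X Y) → IsGaloisPair X Y (Λ-mor f))
    × (∀ {X Y : COML c ℓ} (g : GalMor X Y) → HasAdjoint X Y (Γ (pair g)))
    × (∀ {X Y : COML c ℓ} (f : LinMor X Y) → IsAdjoint Y X (adj f) (fun f))
    × (∀ (X : COML c ℓ) → Λ X X id id ≐₂ idGal X)
    × (∀ {X Y Z : COML c ℓ} (f : LinMor X Y) (g : LinMor Y Z)
    → Λ X Z (fun g ∘ fun f) (adj f ∘ adj g) ≐₂ compGal (Λ-mor g) (Λ-mor f))
    × (∀ {X Y : COML c ℓ} (f g : LinMor X Y) → Λ-mor f ≐₂ Λ-mor g → fun f ≐ fun g)
    × (∀ {X Y : COML c ℓ} (g : GalMor X Y) → Σ (LinMor X Y) (λ f → Λ-mor f ≐₂ pair g))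
    × (∀ {X Y : COML c ℓ} (g : GalMor X Y) (h : Carrier Y → Carrier X)
    → IsAdjoint X Y (Γ (pair g)) h → Λ X Y (Γ (pair g)) h ≐₂ pair g)
    × (∀ {X Y : COML c ℓ} (f : LinMor X Y) → Λ Y X (adj f) (fun f) ≐₂ daggerGal (Λ-mor f))
theorem3 =
    (λ {X} {Y} f → IsAdjoint⇒IsGalois {X = X} {Y} (isAdj f))
  , (λ g → _ , Γ-adjoint g)
  , (λ {X} {Y} f → IsAdjoint-sym {X = X} {Y} (isAdj f))
  , (λ X → (λ _ → refl) , (λ _ → refl))
  , Λ-comp
  , Λ-faithful
  , (λ g → Γ-mor g , Λ∘Γ≐id g _ (Γ-adjoint g))
  , Λ∘Γ≐id
  , (λ f → (λ _ → refl) , (λ _ → refl))
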